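{- Let $P$ be a normal logic program. Every stable partial model of $P$ is a stable trap space of $P$.
   Context: Fix a first-order language with finitely many constant, function and predicate symbols. A normal logic program (NLP) $P$ is a finite set of rules $p \leftarrow p_1,\dots,p_m, \mathord{\sim} p_{m+1},\dots,\mathord{\sim} p_k$ ($k\ge m\ge 0$). $\mathrm{HB}(P)$ is its Herbrand base (possibly infinite), $\mathrm{gr}(P)$ its ground instantiation; for a ground rule $r$: head $\mathrm{head}(r)$, positive/negative body atoms $B^+(r)$, $B^-(r)$, $\mathrm{bf}(r)=\bigwedge_{v\in B^+(r)}v\wedge\bigwedge_{v\in B^-(r)}\neg v$. A three-valued interpretation is a map $I:\mathrm{HB}(P)\to\{0,1,\star\}$; two-valued ones are identified with subsets of $\mathrm{HB}(P)$. $[I]=\{J\subseteq\mathrm{HB}(P): \forall a,\ I(a)\ne\star\Rightarrow J(a)=I(a)\}$. Order $\le_t$: $0<_t\star<_t1$; Kleene evaluation ($\neg\star=\star$, $\wedge$ = $\le_t$-min). $I$ is a three-valued model of a program if $I(\mathrm{bf}(r))\le_t I(\mathrm{head}(r))$ for each ground rule. The reduct $P^I$: from $\mathrm{gr}(P)$ delete every rule with some $b\in B^-(r)$, $I(b)=1$; delete each $\mathord{\sim}b$ with $I(b)=0$; replace each remaining $\mathord{\sim}b$ by a special atom $\mathbf{u}$ always valued $\star$. $P^I$ has a unique $\le_t$-least three-valued model; $I$ is a stable partial model if it equals it. For two-valued $I$, $F_P(I)$ is the $\subseteq$-least model of the Gelfond–Lifschitz reduct (delete rules with some $b\in B^-(r)\cap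 I$, then delete remaining negative literals). A nonempty set $S$ of two-valued interpretations is a stable trap set if $\{F_P(J):J\in S\}\subseteq S$; a three-valued $I$ is a stable trap space if $[I]$ is a stable trap set. -}

module Defs where

open import Data.Nat using (ℕ)
open import Data.Fin using (Fin)
open import Data.Vec using (Vec; []; _∷_)
open import Data.List using (List; []; _∷_; map; _++_)
open import Data.List.Membership.Propositional using (_∈_)
open import Data.List.Relation.Unary.All using (All)
open import Data.Empty using (⊥)
open import Data.Product using (Σ; ∃; _×_; _,_)
open import Relation.Nullary using (¬_)
open import Relation.Binary.PropositionalEquality using (_≡_; _≢_)

record Language : Set where
  field
    nConst  : ℕ
    nFun    : ℕ
    nPred   : ℕ
    funAr   : Fin nFun → ℕ
    predAr  : Fin nPred → ℕ

module _ (L : Language) where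
  open Language L

  data Term (V : Set) : Set where
    var : V → Term V
    con : Fin nConst → Term V
    fun : (f : Fin nFun) → Vec (Term V) (funAr f) → Term V

  record Atom (V : Set) : Set where
    constructor atom
    field
      sym  : Fin nPred
      args : Vec (Term V) (predAr sym)

  -- a rule  head ← pos₁,…,posₘ, ∼neg₁,…,∼negₗ   (variables are naturals)
  record Rule (V : Set) : Set where
    constructor rule
    field
      head : Atom V
      pos  : List (Atom V)
      neg  : List (Atom V)

  Program : Set
  Program = List (Rule ℕ)

  -- Herbrand base: ground atoms; ground rules
  HB : Set
  HB = Atom ⊥

  GRule : Set
  GRule = Rule ⊥

  Subst : Set
  Subst = ℕ → Term ⊥

  mutual
    substT : Subst → Term ℕ → Term ⊥
    substT σ (var x)    = σ x
    substT σ (con c)    = con c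
    substT σ (fun f ts) = fun f (substV σ ts)

    substV : ∀ {n} → Subst → Vec (Term ℕ) n → Vec (Term ⊥) n
    substV σ []       = []
    substV σ (t ∷ ts) = substT σ t ∷ substV σ ts

  substA : Subst → Atom ℕ → Atom ⊥
  substA σ (atom p ts) = atom p (substV σ ts)

  substR : Subst → Rule ℕ → Rule ⊥
  substR σ (rule h ps ns) = rule (substA σ h) (map (substA σ) ps) (map (substA σ) ns)

  gr : Program → GRule → Set
  gr P r = Σ (Rule ℕ) λ ρ → ρ ∈ P × Σ Subst λ σ → r ≡ substR σ ρ

data Three : Set where
  𝟘 ⋆ 𝟙 : Three

data _≤t_ : Three → Three → Set where
  𝟘≤ : ∀ {x} → 𝟘 ≤t x
  ⋆≤⋆ : ⋆ ≤t ⋆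
  ⋆≤𝟙 : ⋆ ≤t 𝟙
  𝟙≤𝟙 : 𝟙 ≤t 𝟙

neg3 : Three → Three
neg3 𝟘 = 𝟙
neg3 ⋆ = ⋆
neg3 𝟙 = 𝟘

_∧3_ : Three → Three → Three
𝟘 ∧3 y = 𝟘
⋆ ∧3 𝟘 = 𝟘
⋆ ∧3 y = ⋆
𝟙 ∧3 y = y

conj : List Three → Three
conj []       = 𝟙
conj (x ∷ xs) = x ∧3 conj xs

module _ {L : Language} where

  Interp3 : Set
  Interp3 = HB L → Three

  -- The reduct P^I.  Bodies of reduct rules consist of atoms and the
  -- special atom 𝐮 (always valued ⋆).

  data RLit : Set where
    at : HB L → RLit
    𝐮  : RLit

  record RRule : Set where
    constructor rrule
    field
      rhead : HB L
      rbody : List RLit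

  -- treatment of the negative literals ∼b of a rule that is kept
  -- (i.e. no b has I(b)=1): drop ∼b if I(b)=0, otherwise replace by 𝐮
  redNeg : Interp3 → List (HB L) → List RLit
  redNeg I []       = []
  redNeg I (b ∷ bs) with I b
  ... | 𝟘 = redNeg I bs
  ... | _ = 𝐮 ∷ redNeg I bs

  data Reduct (P : Program L) (I : Interp3) : RRule → Set where
    keep : (r : GRule L) → gr L P r →
           All (λ b → I b ≢ 𝟙) (Rule.neg r) →
           Reduct P I (rrule (Rule.head r)
                             (map at (Rule.pos r) ++ redNeg I (Rule.neg r)))

  evalLit : Interp3 → RLit → Three
  evalLit M (at a) = M a
  evalLit M 𝐮      = ⋆

  ModelOfReduct : Program L → Interp3 → Interp3 → Set
  ModelOfReduct P I M = ∀ rr → Reduct P I rr →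
    conj (map (evalLit M) (RRule.rbody rr)) ≤t M (RRule.rhead rr)

  StablePartialModel : Program L → Interp3 → Set
  StablePartialModel P I =
    ModelOfReduct P I I × (∀ M → ModelOfReduct P I M → ∀ a → I a ≤t M a)

  Interp2 : Set₁
  Interp2 = HB L → Set

  -- F_P(J): the least model of the Gelfond–Lifschitz reduct P^J,
  -- given inductively (atoms derivable by the rules of the reduct)
  data F (P : Program L) (J : Interp2) : HB L → Set where
    derive : (r : GRule L) → gr L P r →
             All (λ b → ¬ J b) (Rule.neg r) →
             All (F P J) (Rule.pos r) →
             F P J (Rule.head r)

  InBox : Interp3 → Interp2 → Set
  InBox I J = ∀ a → (I a ≡ 𝟙 → J a) × (I a ≡ 𝟘 → ¬ J a)

  StableTrapSet : Program L → (Interp2 → Set) → Set₁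
  StableTrapSet P S = (Σ Interp2 S) × (∀ J → S J → S (F P J))

  StableTrapSpace : Program L → Interp3 → Set₁
  StableTrapSpace P I = StableTrapSet P (InBox I)

{-# OPTIONS --safe #-}
module Submission where

-- Let J ∈ [I].  Every rule usable in the Gelfond–Lifschitz reduct P^J is kept
-- in P^I, and its reduced body never evaluates to 0 under I once its positive
-- atoms do not; as I is a model of P^I, induction on derivations gives
-- I a ≠ 0 for every a ∈ F_P(J).  Conversely the interpretation valuing F_P(J)
-- as 1 and everything else as ⋆ is a model of P^I, because a reduced body
-- valued 1 is a GL-derivation step; minimality of I then gives I a = 1 ⇒
-- a ∈ F_P(J).  Hence F_P(J) ∈ [I], and [I] is nonempty since it contains the
-- set of atoms true in I.

open import Defs
open import Level using (0ℓ)
open import Axiom.ExcludedMiddle using (ExcludedMiddle)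
open import Data.List using ([]; _∷_; map; _++_)
open import Data.List.Relation.Unary.All as All using (All; []; _∷_)
open import Data.List.Relation.Unary.All.Properties using (map⁺; map⁻; ++⁺; ++⁻)
open import Data.Product as Product using (_×_; _,_)
open import Function using (id)
open import Relation.Nullary using (¬_; yes; no)
open import Relation.Nullary.Negation using (contradiction)
open import Relation.Binary.PropositionalEquality using (_≡_; _≢_; refl; sym; trans)

∧3-≢𝟘 : ∀ {x y} → x ≢ 𝟘 → y ≢ 𝟘 → x ∧3 y ≢ 𝟘
∧3-≢𝟘 {𝟘}       x≢𝟘 _   = x≢𝟘
∧3-≢𝟘 {⋆} {𝟘}   _   y≢𝟘 = y≢𝟘
∧3-≢𝟘 {⋆} {⋆}   _   _   ()
∧3-≢𝟘 {⋆} {𝟙}   _   _   ()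
∧3-≢𝟘 {𝟙}       _   y≢𝟘 = y≢𝟘

∧3-≡𝟙 : ∀ {x y} → x ∧3 y ≡ 𝟙 → x ≡ 𝟙 × y ≡ 𝟙
∧3-≡𝟙 {𝟘}     ()
∧3-≡𝟙 {⋆} {𝟘} ()
∧3-≡𝟙 {⋆} {⋆} ()
∧3-≡𝟙 {⋆} {𝟙} ()
∧3-≡𝟙 {𝟙}     y≡𝟙 = refl , y≡𝟙

conj-≢𝟘 : ∀ {xs} → All (_≢ 𝟘) xs → conj xs ≢ 𝟘
conj-≢𝟘 []           ()
conj-≢𝟘 (x≢𝟘 ∷ xs≢𝟘) = ∧3-≢𝟘 x≢𝟘 (conj-≢𝟘 xs≢𝟘)

conj-≡𝟙 : ∀ xs → conj xs ≡ 𝟙 → All (_≡ 𝟙) xs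
conj-≡𝟙 []       _   = []
conj-≡𝟙 (x ∷ xs) eq with ∧3-≡𝟙 {x} eq
... | x≡𝟙 , xs≡𝟙 = x≡𝟙 ∷ conj-≡𝟙 xs xs≡𝟙

≤t-≢𝟘 : ∀ {x y} → x ≤t y → x ≢ 𝟘 → y ≢ 𝟘
≤t-≢𝟘 𝟘≤  x≢𝟘 = contradiction refl x≢𝟘
≤t-≢𝟘 ⋆≤⋆ _   ()
≤t-≢𝟘 ⋆≤𝟙 _   ()
≤t-≢𝟘 𝟙≤𝟙 _   ()

≤t-≡𝟙 : ∀ {x y} → x ≤t y → x ≡ 𝟙 → y ≡ 𝟙
≤t-≡𝟙 𝟘≤  ()
≤t-≡𝟙 ⋆≤⋆ ()
≤t-≡𝟙 ⋆≤𝟙 ()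
≤t-≡𝟙 𝟙≤𝟙 refl = refl

x≤t𝟙 : ∀ x → x ≤t 𝟙
x≤t𝟙 𝟘 = 𝟘≤
x≤t𝟙 ⋆ = ⋆≤𝟙
x≤t𝟙 𝟙 = 𝟙≤𝟙

≢𝟙⇒≤t⋆ : ∀ {x} → x ≢ 𝟙 → x ≤t ⋆
≢𝟙⇒≤t⋆ {𝟘} _   = 𝟘≤
≢𝟙⇒≤t⋆ {⋆} _   = ⋆≤⋆
≢𝟙⇒≤t⋆ {𝟙} x≢𝟙 = contradiction refl x≢𝟙

module _ {L : Language} where

  indicator : ExcludedMiddle 0ℓ → (HB L → Set) → Interp3 {L}
  indicator em S a with em {S a}
  ... | yes _ = 𝟙
  ... | no  _ = ⋆

  indicator-≡𝟙 : (em : ExcludedMiddle 0ℓ) (S : HB L → Set) →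
                 ∀ a → indicator em S a ≡ 𝟙 → S a
  indicator-≡𝟙 em S a eq with em {S a}
  indicator-≡𝟙 em S a refl | yes Sa = Sa

  module _ {I : Interp3 {L}} where

    redNeg-𝐮 : ∀ ns → All (_≡ 𝐮) (redNeg I ns)
    redNeg-𝐮 []       = []
    redNeg-𝐮 (b ∷ bs) with I b
    ... | 𝟘 = redNeg-𝐮 bs
    ... | ⋆ = refl ∷ redNeg-𝐮 bs
    ... | 𝟙 = refl ∷ redNeg-𝐮 bs

    redNeg-≡𝟙 : ∀ M ns → All (λ l → evalLit M l ≡ 𝟙) (redNeg I ns) →
                All (λ b → I b ≡ 𝟘) ns
    redNeg-≡𝟙 M []       _ = []
    redNeg-≡𝟙 M (b ∷ bs) h with I b in Ib
    redNeg-≡𝟙 M (b ∷ bs) h        | 𝟘 = Ib ∷ redNeg-≡𝟙 M bs h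
    redNeg-≡𝟙 M (b ∷ bs) (() ∷ _) | ⋆
    redNeg-≡𝟙 M (b ∷ bs) (() ∷ _) | 𝟙

    reductBody-≢𝟘 : ∀ M ps ns → All (λ a → M a ≢ 𝟘) ps →
                    conj (map (evalLit M) (map at ps ++ redNeg I ns)) ≢ 𝟘
    reductBody-≢𝟘 M ps ns ps≢𝟘 =
      conj-≢𝟘 (map⁺ (++⁺ (map⁺ ps≢𝟘) (All.map 𝐮≢𝟘 (redNeg-𝐮 ns))))
      where
      𝐮≢𝟘 : ∀ {l} → l ≡ 𝐮 → evalLit M l ≢ 𝟘
      𝐮≢𝟘 refl ()

    reductBody-≡𝟙 : ∀ M ps ns →
                    conj (map (evalLit M) (map at ps ++ redNeg I ns)) ≡ 𝟙 →
                    All (λ a → M a ≡ 𝟙) ps × All (λ b → I b ≡ 𝟘) ns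
    reductBody-≡𝟙 M ps ns eq =
      Product.map map⁻ (redNeg-≡𝟙 M ns)
        (++⁻ (map at ps) (map⁻ (conj-≡𝟙 (map (evalLit M) (map at ps ++ redNeg I ns)) eq)))

    module _ {P : Program L} {J : Interp2 {L}} where

      mutual
        F-≢𝟘 : ModelOfReduct P I I → (∀ b → I b ≡ 𝟙 → J b) →
               ∀ {a} → F P J a → I a ≢ 𝟘
        F-≢𝟘 model upper (derive r r∈P negs poss) =
          ≤t-≢𝟘 (model _ (keep r r∈P (All.map (λ ¬Jb Ib≡𝟙 → ¬Jb (upper _ Ib≡𝟙)) negs)))
                (reductBody-≢𝟘 I (Rule.pos r) (Rule.neg r) (All-F-≢𝟘 model upper poss))

        All-F-≢𝟘 : ModelOfReduct P I I → (∀ b → I b ≡ 𝟙 → J b) →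
                   ∀ {as} → All (F P J) as → All (λ a → I a ≢ 𝟘) as
        All-F-≢𝟘 model upper []         = []
        All-F-≢𝟘 model upper (Fa ∷ Fas) = F-≢𝟘 model upper Fa ∷ All-F-≢𝟘 model upper Fas

      indicator-F-model : (em : ExcludedMiddle 0ℓ) → (∀ b → I b ≡ 𝟘 → ¬ J b) →
                          ModelOfReduct P I (indicator em (F P J))
      indicator-F-model em lower _ (keep r r∈P _) with em {F P J (Rule.head r)}
      ... | yes _  = x≤t𝟙 _
      ... | no ¬Fh = ≢𝟙⇒≤t⋆ λ body≡𝟙 →
        let pos≡𝟙 , neg≡𝟘 = reductBody-≡𝟙 M (Rule.pos r) (Rule.neg r) body≡𝟙
        in ¬Fh (derive r r∈P (All.map (lower _) neg≡𝟘)
                             (All.map (indicator-≡𝟙 em (F P J) _) pos≡𝟙))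
        where
        M : Interp3 {L}
        M = indicator em (F P J)

      F-InBox : ExcludedMiddle 0ℓ → StablePartialModel P I → InBox I J → InBox I (F P J)
      F-InBox em (model , least) J∈[I] a =
          (λ Ia≡𝟙 → indicator-≡𝟙 em (F P J) a
                      (≤t-≡𝟙 (least _ (indicator-F-model em lower) a) Ia≡𝟙))
        , (λ Ia≡𝟘 Fa → F-≢𝟘 model upper Fa Ia≡𝟘)
        where
        upper : ∀ b → I b ≡ 𝟙 → J b
        upper b = Product.proj₁ (J∈[I] b)
        lower : ∀ b → I b ≡ 𝟘 → ¬ J b
        lower b = Product.proj₂ (J∈[I] b)

    trueAtoms-InBox : InBox I (λ a → I a ≡ 𝟙)
    trueAtoms-InBox a = id , λ Ia≡𝟘 Ia≡𝟙 → contradiction (trans (sym Ia≡𝟘) Ia≡𝟙) λ ()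

proposition4p3 : ExcludedMiddle 0ℓ →
    (L : Language) (P : Program L) (I : Interp3 {L}) →
    StablePartialModel P I → StableTrapSpace P I
proposition4p3 em L P I spm =
  (_ , trueAtoms-InBox) , λ J J∈[I] → F-InBox em spm J∈[I]
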